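{- Let $P$ be a normal logic program that is uni-rule, i.e., every atom of $\mathrm{HB}(P)$ is the head of at most one rule of $\mathrm{gr}(P)$. Then $P$ has at least one L-stable model.
   Context: Fix a first-order language with finitely many constant, function and predicate symbols. A normal logic program (NLP) $P$ is a finite set of rules $p \leftarrow p_1,\dots,p_m, \mathord{\sim} p_{m+1},\dots,\mathord{\sim} p_k$ ($k\ge m\ge 0$). $\mathrm{HB}(P)$ is its Herbrand base (possibly infinite), $\mathrm{gr}(P)$ its ground instantiation; for a ground rule $r$: head $\mathrm{head}(r)$, positive/negative body atoms $B^+(r)$, $B^-(r)$, $\mathrm{bf}(r)=\bigwedge_{v\in B^+(r)}v\wedge\bigwedge_{v\in B^-(r)}\neg v$. A three-valued interpretation is a map $I:\mathrm{HB}(P)\to\{0,1,\star\}$; $I^{\mathbf{u}}=\{a: I(a)=\star\}$. Order $\le_t$: $0<_t\star<_t1$; Kleene evaluation ($\neg\star=\star$, $\wedge$ = $\le_t$-min). $I$ is a three-valued model of a program if $I(\mathrm{bf}(r))\le_t I(\mathrm{head}(r))$ for each ground rule. The reduct $P^I$: from $\mathrm{gr}(P)$ delete every rule with some $b\in B^-(r)$, $I(b)=1$; delete each $\mathord{\sim}b$ with $I(b)=0$; replace each remaining $\mathord{\sim}b$ by a special atom $\mathbf{u}$ always valued $\star$. $P^I$ has a unique $\le_t$-least three-valued model; $I$ is a stable partial model if it equals it. $I$ is an L-stable model if it is a stable partial model and there is no stable partial model $J$ with $J^{\mathbf{u}}\subsetneq I^{\mathbf{u}}$. -}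

module Defs where

open import Data.Nat using (ℕ; zero; suc)
open import Data.Fin using (Fin)
open import Data.Vec using (Vec; []; _∷_)
open import Data.List using (List; []; _∷_; map; foldr; _++_; replicate)
open import Data.List.Membership.Propositional using (_∈_)
open import Data.List.Relation.Unary.All using (All)
open import Data.Product using (Σ; Σ-syntax; ∃; ∃-syntax; _×_; _,_)
open import Relation.Binary.PropositionalEquality using (_≡_; _≢_)
open import Relation.Nullary using (¬_)

record Signature : Set where
  field
    nConst  : ℕ
    nFun    : ℕ
    funAr   : Fin nFun → ℕ
    nPred   : ℕ
    predAr  : Fin nPred → ℕ

module _ (L : Signature) where
  open Signature L

  data Term : Set where
    var   : ℕ → Term
    const : Fin nConst → Term
    app   : (f : Fin nFun) → Vec Term (funAr f) → Term

  data GTerm : Set where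
    gconst : Fin nConst → GTerm
    gapp   : (f : Fin nFun) → Vec GTerm (funAr f) → GTerm

  data Atom : Set where
    atom : (p : Fin nPred) → Vec Term (predAr p) → Atom

  data GAtom : Set where
    gatom : (p : Fin nPred) → Vec GTerm (predAr p) → GAtom

  substT  : (ℕ → GTerm) → Term → GTerm
  substTs : ∀ {n} → (ℕ → GTerm) → Vec Term n → Vec GTerm n
  substT σ (var x)      = σ x
  substT σ (const c)    = gconst c
  substT σ (app f ts)   = gapp f (substTs σ ts)
  substTs σ []       = []
  substTs σ (t ∷ ts) = substT σ t ∷ substTs σ ts

  substA : (ℕ → GTerm) → Atom → GAtom
  substA σ (atom p ts) = gatom p (substTs σ ts)

record Rule (A : Set) : Set where
  constructor rule
  field
    head : A
    pos  : List A
    neg  : List A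
open Rule public

Program : Signature → Set
Program L = List (Rule (Atom L))

groundRule : ∀ {L} → (ℕ → GTerm L) → Rule (Atom L) → Rule (GAtom L)
groundRule σ r = rule (substA _ σ (head r)) (map (substA _ σ) (pos r)) (map (substA _ σ) (neg r))

InGr : ∀ {L} → Program L → Rule (GAtom L) → Set
InGr P r = Σ[ r₀ ∈ _ ] (r₀ ∈ P) × (Σ[ σ ∈ (ℕ → _) ] groundRule σ r₀ ≡ r)

-- equality of ground rules as rules (bodies compared as sets of literals)
SameRule : ∀ {A : Set} → Rule A → Rule A → Set
SameRule r s =
  head r ≡ head s
  × (∀ {a} → a ∈ pos r → a ∈ pos s) × (∀ {a} → a ∈ pos s → a ∈ pos r)
  × (∀ {a} → a ∈ neg r → a ∈ neg s) × (∀ {a} → a ∈ neg s → a ∈ neg r)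

UniRule : ∀ {L} → Program L → Set
UniRule P = ∀ r s → InGr P r → InGr P s → head r ≡ head s → SameRule r s

data V : Set where
  𝟘 ⋆ 𝟙 : V

data _≤t_ : V → V → Set where
  0≤ : ∀ {v} → 𝟘 ≤t v
  ⋆≤⋆ : ⋆ ≤t ⋆
  ⋆≤1 : ⋆ ≤t 𝟙
  1≤1 : 𝟙 ≤t 𝟙

¬v : V → V
¬v 𝟘 = 𝟙
¬v ⋆ = ⋆
¬v 𝟙 = 𝟘

_∧v_ : V → V → V
𝟘 ∧v _ = 𝟘
⋆ ∧v 𝟘 = 𝟘
⋆ ∧v _ = ⋆
𝟙 ∧v w = w

conj : List V → V
conj = foldr _∧v_ 𝟙

Interp : Signature → Set
Interp L = GAtom L → V

-- Reduct P^I.  A rule of the reduct has a head, positive body atoms, and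
-- a number of occurrences of the special atom u (always valued ⋆).

record RRule (A : Set) : Set where
  constructor rrule
  field
    rhead : A
    rpos  : List A
    nu    : ℕ
open RRule public

-- the negative literals that survive (those ∼b with I(b) ≠ 0) become u
countU : ∀ {L} → Interp L → List (GAtom L) → ℕ
countU I []       = zero
countU I (b ∷ bs) with I b
... | 𝟘 = countU I bs
... | _ = suc (countU I bs)

InReduct : ∀ {L} → Program L → Interp L → RRule (GAtom L) → Set
InReduct P I rr =
  Σ[ r ∈ Rule _ ] InGr P r
    × All (λ b → I b ≢ 𝟙) (neg r)
    × rr ≡ rrule (head r) (pos r) (countU I (neg r))

evalR : ∀ {L} → Interp L → RRule (GAtom L) → V
evalR J rr = conj (map J (rpos rr) ++ replicate (nu rr) ⋆)

ModelOfReduct : ∀ {L} → Program L → Interp L → Interp L → Set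
ModelOfReduct P I J = ∀ rr → InReduct P I rr → evalR J rr ≤t J (rhead rr)

StablePartial : ∀ {L} → Program L → Interp L → Set
StablePartial P I =
  ModelOfReduct P I I × (∀ K → ModelOfReduct P I K → ∀ a → I a ≤t K a)

_⊊u_ : ∀ {L} → Interp L → Interp L → Set
J ⊊u I = (∀ a → J a ≡ ⋆ → I a ≡ ⋆) × (∃[ a ] (I a ≡ ⋆ × J a ≢ ⋆))

LStable : ∀ {L} → Program L → Interp L → Set
LStable P I = StablePartial P I × ¬ (∃[ J ] (StablePartial P J × J ⊊u I))

-- Under uni-rule each atom heads at most one rule of gr(P), so all derivations of an atom have the
-- same shape and rest on the same finite set of negative assumptions.  A three-valued interpretation
-- I is then a stable partial model iff, for every atom a, I(a) = 1 exactly when a has a derivation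
-- whose negative assumptions are false in I, and I(a) ≠ 0 exactly when it has one whose negative
-- assumptions are not true in I.  This condition inspects finitely many atoms at a time, so the
-- stable partial models form a closed subset of the compact space {0,⋆,1}^HB(P) (HB(P) is countable),
-- and the limit of the Kleene iteration of the derivability operator from the everywhere-⋆
-- interpretation is one of them.  Enumerate HB(P) and decide greedily, atom by atom, whether it can
-- be made known together with the atoms forced before it.  Every finite stage of this choice is
-- realised by a stable partial model, so by compactness some stable partial model leaves only
-- unforced atoms unknown.  It is L-stable: a stable partial model with fewer unknowns would also
-- leave only unforced atoms unknown while making one of them known, against the greedy choice.

module Submission where

open import Defs
open import Level using (0ℓ)
open import Axiom.ExcludedMiddle using (ExcludedMiddle)
open import Data.Product using (∃)

open import Axiom.DoubleNegationElimination using (em⇒dne)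
open import Data.Bool using (Bool; true; false)
open import Data.Empty using (⊥; ⊥-elim)
open import Data.Fin using (toℕ)
open import Data.Fin.Properties using (toℕ-injective)
open import Data.List using (List; []; _∷_; _++_; map; replicate)
open import Data.List.Membership.Propositional using (_∈_)
open import Data.List.Membership.Propositional.Properties using (∈-++⁺ˡ; ∈-++⁺ʳ; ∈-++⁻)
open import Data.List.Relation.Unary.All as All using (All; []; _∷_)
open import Data.List.Relation.Unary.All.Properties using (++⁺; ++⁻; map⁺; map⁻)
open import Data.List.Relation.Unary.Any using (here; there)
open import Data.Nat using (ℕ; zero; suc; _≤_; _<_; _⊔_; z≤n; s≤s; _≟_)
open import Data.Nat.Binary using (ℕᵇ; 2[1+_]; 1+[2_])
  renaming (zero to εᵇ; toℕ to toℕᵇ)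
open import Data.Nat.Binary.Properties using (2[1+_]-injective; 1+[2_]-injective)
  renaming (toℕ-injective to toℕᵇ-injective)
open import Data.Nat.Properties using (≤-refl; n≤1+n; ≤-trans; ≤-total; <-≤-trans; <⇒≢; m≤m⊔n; m≤n⊔m; m<1+n⇒m<n∨m≡n)
open import Data.Product using (Σ; _×_; _,_; proj₁; proj₂; uncurry)
open import Data.Sum using (inj₁; inj₂; [_,_]′)
open import Data.Vec using (Vec; []; _∷_)
open import Function using (_∘_; id)
open import Function.Bundles using (_⇔_; mk⇔; module Equivalence)
open import Function.Definitions using (Injective)
open import Relation.Binary.PropositionalEquality using (_≡_; _≢_; refl; sym; trans; cong; cong-app; subst; module ≡-Reasoning)
open import Relation.Nullary using (¬_; yes; no; does)
open import Relation.Nullary.Decidable using (dec-true; dec-false)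

open Equivalence using (to; from)

≡𝟘⇒≢𝟙 : ∀ {x} → x ≡ 𝟘 → x ≢ 𝟙
≡𝟘⇒≢𝟙 refl ()

≡𝟘⇒≢⋆ : ∀ {x} → x ≡ 𝟘 → x ≢ ⋆
≡𝟘⇒≢⋆ refl ()

≡𝟙⇒≢⋆ : ∀ {x} → x ≡ 𝟙 → x ≢ ⋆
≡𝟙⇒≢⋆ refl ()

≤t-intro : ∀ {x y} → (x ≡ 𝟙 → y ≡ 𝟙) → (x ≢ 𝟘 → y ≢ 𝟘) → x ≤t y
≤t-intro {𝟘}          _ _    = 0≤
≤t-intro {⋆} {𝟘}      _ ≢𝟘   = ⊥-elim (≢𝟘 (λ ()) refl)
≤t-intro {⋆} {⋆}      _ _    = ⋆≤⋆
≤t-intro {⋆} {𝟙}      _ _    = ⋆≤1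
≤t-intro {𝟙} to𝟙 _ with to𝟙 refl
... | refl = 1≤1

≤t-𝟙 : ∀ {x y} → x ≤t y → x ≡ 𝟙 → y ≡ 𝟙
≤t-𝟙 1≤1 _ = refl

≤t-≢𝟘 : ∀ {x y} → x ≤t y → x ≢ 𝟘 → y ≢ 𝟘
≤t-≢𝟘 0≤  x≢𝟘 = ⊥-elim (x≢𝟘 refl)
≤t-≢𝟘 ⋆≤⋆ _   = λ ()
≤t-≢𝟘 ⋆≤1 _   = λ ()
≤t-≢𝟘 1≤1 _   = λ ()

∧v-𝟙 : ∀ x y → x ∧v y ≡ 𝟙 ⇔ (x ≡ 𝟙 × y ≡ 𝟙)
∧v-𝟙 x y = mk⇔ (split x y) (uncurry join)
  where
  split : ∀ x y → x ∧v y ≡ 𝟙 → x ≡ 𝟙 × y ≡ 𝟙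
  split 𝟙 _ e = refl , e
  split 𝟘 _ ()
  split ⋆ 𝟘 ()
  split ⋆ ⋆ ()
  split ⋆ 𝟙 ()
  join : ∀ {x y} → x ≡ 𝟙 → y ≡ 𝟙 → x ∧v y ≡ 𝟙
  join refl refl = refl

∧v-≢𝟘 : ∀ x y → x ∧v y ≢ 𝟘 ⇔ (x ≢ 𝟘 × y ≢ 𝟘)
∧v-≢𝟘 x y = mk⇔ (split x y) (uncurry (join x y))
  where
  split : ∀ x y → x ∧v y ≢ 𝟘 → x ≢ 𝟘 × y ≢ 𝟘
  split 𝟘 _ ≢𝟘 = ⊥-elim (≢𝟘 refl)
  split ⋆ 𝟘 ≢𝟘 = ⊥-elim (≢𝟘 refl)
  split ⋆ ⋆ _  = (λ ()) , (λ ())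
  split ⋆ 𝟙 _  = (λ ()) , (λ ())
  split 𝟙 _ ≢𝟘 = (λ ()) , ≢𝟘
  join : ∀ x y → x ≢ 𝟘 → y ≢ 𝟘 → x ∧v y ≢ 𝟘
  join 𝟘 _ x≢𝟘 _   = ⊥-elim (x≢𝟘 refl)
  join ⋆ 𝟘 _ y≢𝟘   = ⊥-elim (y≢𝟘 refl)
  join ⋆ ⋆ _ _     = λ ()
  join ⋆ 𝟙 _ _     = λ ()
  join 𝟙 _ _ y≢𝟘   = y≢𝟘

conj-𝟙 : ∀ xs → conj xs ≡ 𝟙 ⇔ All (_≡ 𝟙) xs
conj-𝟙 []       = mk⇔ (λ _ → []) (λ _ → refl)
conj-𝟙 (x ∷ xs) = mk⇔
  (λ e → let x≡𝟙 , xs≡𝟙 = to (∧v-𝟙 x (conj xs)) e in x≡𝟙 ∷ to (conj-𝟙 xs) xs≡𝟙)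
  (λ where (x≡𝟙 ∷ xs≡𝟙) → from (∧v-𝟙 x (conj xs)) (x≡𝟙 , from (conj-𝟙 xs) xs≡𝟙))

conj-≢𝟘 : ∀ xs → conj xs ≢ 𝟘 ⇔ All (_≢ 𝟘) xs
conj-≢𝟘 []       = mk⇔ (λ _ → []) (λ _ ())
conj-≢𝟘 (x ∷ xs) = mk⇔
  (λ e → let x≢𝟘 , xs≢𝟘 = to (∧v-≢𝟘 x (conj xs)) e in x≢𝟘 ∷ to (conj-≢𝟘 xs) xs≢𝟘)
  (λ where (x≢𝟘 ∷ xs≢𝟘) → from (∧v-≢𝟘 x (conj xs)) (x≢𝟘 , from (conj-≢𝟘 xs) xs≢𝟘))

replicate-⋆-𝟙 : ∀ n → All (_≡ 𝟙) (replicate n ⋆) ⇔ n ≡ 0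
replicate-⋆-𝟙 n = mk⇔ (only-zero n) (λ where refl → [])
  where
  only-zero : ∀ n → All (_≡ 𝟙) (replicate n ⋆) → n ≡ 0
  only-zero zero    _        = refl
  only-zero (suc n) (() ∷ _)

replicate-⋆-≢𝟘 : ∀ n → All (_≢ 𝟘) (replicate n ⋆)
replicate-⋆-≢𝟘 zero    = []
replicate-⋆-≢𝟘 (suc n) = (λ ()) ∷ replicate-⋆-≢𝟘 n

Eventually : (ℕ → Set) → Set
Eventually Q = ∃ λ k → ∀ {j} → k ≤ j → Q j

eventually-all : ∀ {A : Set} {Q : A → ℕ → Set} (xs : List A) → (∀ x → Eventually (Q x)) →
                 Eventually (λ j → ∀ {x} → x ∈ xs → Q x j)
eventually-all []       _  = 0 , λ _ ()
eventually-all (x ∷ xs) ev with ev x | eventually-all xs ev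
... | k , Qx | l , Qxs = k ⊔ l , λ where
  k⊔l≤j (here refl) → Qx  (≤-trans (m≤m⊔n k l) k⊔l≤j)
  k⊔l≤j (there x∈)  → Qxs (≤-trans (m≤n⊔m k l) k⊔l≤j) x∈

module _ {B : Set} where

  _[_≔_] : (ℕ → B) → ℕ → B → ℕ → B
  (f [ n ≔ b ]) k with k ≟ n
  ... | yes _ = b
  ... | no _  = f k

  [≔]-≡ : ∀ f n {b} → (f [ n ≔ b ]) n ≡ b
  [≔]-≡ f n with n ≟ n
  ... | yes _  = refl
  ... | no n≢n = ⊥-elim (n≢n refl)

  [≔]-≢ : ∀ f {n b k} → k ≢ n → (f [ n ≔ b ]) k ≡ f k
  [≔]-≢ f {n} {k = k} k≢n with k ≟ n
  ... | yes k≡n = ⊥-elim (k≢n k≡n)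
  ... | no _    = refl

  updates-stabilise : (f : ℕ → ℕ → B) (g : ℕ → B) → (∀ n → f (suc n) ≡ f n [ n ≔ g n ]) →
                      ∀ {n k} → k < n → f n k ≡ g k
  updates-stabilise f g step {suc n} {k} k<1+n with m<1+n⇒m<n∨m≡n k<1+n
  ... | inj₁ k<n  = begin
    f (suc n) k          ≡⟨ cong-app (step n) k ⟩
    (f n [ n ≔ g n ]) k  ≡⟨ [≔]-≢ (f n) (<⇒≢ k<n) ⟩
    f n k                ≡⟨ updates-stabilise f g step k<n ⟩
    g k                  ∎
    where open ≡-Reasoning
  ... | inj₂ refl = trans (cong-app (step n) k) ([≔]-≡ (f n) n)

-- Closed sets of interpretations over a countable set of atoms

module _ {A : Set} where

  _⊆ᵘ_ : (A → V) → (A → V) → Set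
  J ⊆ᵘ K = ∀ a → J a ≡ ⋆ → K a ≡ ⋆

  InClosure : ((A → V) → Set) → (A → V) → Set
  InClosure S K = ∀ (xs : List A) → ∃ λ J → S J × (∀ {b} → b ∈ xs → J b ≡ K b)

  IsClosed : ((A → V) → Set) → Set
  IsClosed S = ∀ K → InClosure S K → S K

module Countable (em : ExcludedMiddle 0ℓ) {A : Set} (code : A → ℕ) (code-injective : Injective _≡_ _≡_ code)
  where

  dne : ∀ {X : Set} → ¬ ¬ X → X
  dne = em⇒dne em

  ¬∀⇒∃¬ : ∀ {Q : ℕ → Set} → ¬ (∀ m → Q m) → ∃ λ m → ¬ Q m
  ¬∀⇒∃¬ ¬∀ = dne λ ¬∃ → ¬∀ λ m → dne λ ¬Q → ¬∃ (m , ¬Q)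

  AgreeBelow : ℕ → (A → V) → (A → V) → Set
  AgreeBelow n J K = ∀ {a} → code a < n → J a ≡ K a

  -- ⋆ is a junk value for codes of no atom
  valueAt : (A → V) → ℕ → V
  valueAt J n with em {∃ λ a → code a ≡ n}
  ... | yes (a , _) = J a
  ... | no _        = ⋆

  valueAt-code : ∀ J {a} → J a ≡ valueAt J (code a)
  valueAt-code J {a} with em {∃ λ b → code b ≡ code a}
  ... | yes (b , cb≡ca) = cong J (code-injective (sym cb≡ca))
  ... | no none         = ⊥-elim (none (a , refl))

  agree-update : ∀ {n J c} → AgreeBelow n J (c ∘ code) → AgreeBelow (suc n) J ((c [ n ≔ valueAt J n ]) ∘ code)
  agree-update {J = J} {c = c} agree {a} lt with m<1+n⇒m<n∨m≡n lt
  ... | inj₁ lt′ = trans (agree lt′) (sym ([≔]-≢ c (<⇒≢ lt′)))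
  ... | inj₂ refl = trans (valueAt-code J) (sym ([≔]-≡ c (code a)))

  module _ (F : ℕ → (A → V) → Set) (F-anti : ∀ {m m′ J} → m ≤ m′ → F m′ J → F m J)
           (F-nonempty : ∀ m → ∃ (F m)) where

    Extendable : ℕ → (ℕ → V) → Set
    Extendable n c = ∀ m → ∃ λ J → F m J × AgreeBelow n J (c ∘ code)

    -- If every value v failed at some stage m_v, a member of F (max m_v) would refute all three at once.
    extend : ∀ {n} c → Extendable n c → ∃ λ v → Extendable (suc n) (c [ n ≔ v ])
    extend {n} c ext = dne λ stuck → no-value-extends λ v e → stuck (v , e)
      where
      no-value-extends : (∀ v → ¬ Extendable (suc n) (c [ n ≔ v ])) → ⊥
      no-value-extends stuck =
        let J , FJ , agree = ext M
        in proj₂ (failure (valueAt J n)) (J , F-anti (failure≤M _) FJ , agree-update {c = c} agree)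
        where
        failure : ∀ v → ∃ λ m → ¬ ∃ λ J → F m J × AgreeBelow (suc n) J ((c [ n ≔ v ]) ∘ code)
        failure v = ¬∀⇒∃¬ (stuck v)
        m₀ m⋆ m₁ M : ℕ
        m₀ = proj₁ (failure 𝟘)
        m⋆ = proj₁ (failure ⋆)
        m₁ = proj₁ (failure 𝟙)
        M = m₀ ⊔ m⋆ ⊔ m₁
        failure≤M : ∀ v → proj₁ (failure v) ≤ M
        failure≤M 𝟘 = ≤-trans (m≤m⊔n m₀ m⋆) (m≤m⊔n _ m₁)
        failure≤M ⋆ = ≤-trans (m≤n⊔m m₀ m⋆) (m≤m⊔n _ m₁)
        failure≤M 𝟙 = m≤n⊔m (m₀ ⊔ m⋆) m₁

    prefix : ∀ n → Σ (ℕ → V) (Extendable n)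
    prefix zero    = (λ _ → ⋆) , λ m → proj₁ (F-nonempty m) , proj₂ (F-nonempty m) , λ ()
    prefix (suc n) = let c , ext = prefix n
                         v , ext′ = extend c ext
                     in c [ n ≔ v ] , ext′

    choice : ℕ → V
    choice n = proj₁ (extend (proj₁ (prefix n)) (proj₂ (prefix n)))

    compactness : ∃ λ K → ∀ n m → ∃ λ J → F m J × AgreeBelow n J K
    compactness = choice ∘ code , λ n m →
      let J , FJ , agree = proj₂ (prefix n) m
      in J , FJ , λ lt → trans (agree lt) (updates-stabilise (proj₁ ∘ prefix) choice (λ _ → refl) lt)

  module _ (S : (A → V) → Set) (S-nonempty : ∃ S) where

    AvoidsBelow : (ℕ → Bool) → ℕ → (A → V) → Set
    AvoidsBelow R n J = ∀ {a} → J a ≡ ⋆ → code a < n → R (code a) ≡ false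

    Forceable : (ℕ → Bool) → ℕ → Set
    Forceable R n = ∃ λ J → S J × AvoidsBelow R n J × (∀ {a} → J a ≡ ⋆ → code a ≢ n)

    -- Greedily, code n is forced (to be known) iff that is compatible with the codes forced before it.
    forcedBelow : ℕ → ℕ → Bool
    forced : ℕ → Bool
    forcedBelow zero    = λ _ → false
    forcedBelow (suc n) = forcedBelow n [ n ≔ forced n ]
    forced n = does (em {Forceable (forcedBelow n) n})

    forcedBelow-forced : ∀ {n k} → k < n → forcedBelow n k ≡ forced k
    forcedBelow-forced = updates-stabilise forcedBelow forced λ _ → refl

    forced-satisfiable : ∀ n → ∃ λ J → S J × AvoidsBelow forced n J
    forced-satisfiable zero = proj₁ S-nonempty , proj₂ S-nonempty , λ _ ()
    forced-satisfiable (suc n) with em {Forceable (forcedBelow n) n}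
    ... | yes (J , SJ , avoids , known) = J , SJ , λ unknown lt → [
            (λ lt′ → trans (sym (forcedBelow-forced lt′)) (avoids unknown lt′)) ,
            (λ code≡n → ⊥-elim (known unknown code≡n)) ]′ (m<1+n⇒m<n∨m≡n lt)
    ... | no ¬forceable with forced-satisfiable n
    ...   | J , SJ , avoids = J , SJ , λ unknown lt → [
            avoids unknown ,
            (λ where refl → dec-false (em {Forceable (forcedBelow n) n}) ¬forceable) ]′ (m<1+n⇒m<n∨m≡n lt)

    unforced-unknown : ∀ {J} → S J → (∀ {a} → J a ≡ ⋆ → forced (code a) ≡ false) →
                       ∀ {a} → forced (code a) ≡ false → J a ≡ ⋆
    unforced-unknown {J} SJ avoids {a₀} unforced =
      dne λ known → true≢false (trans (sym (forced-true known)) unforced)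
      where
      true≢false : true ≢ false
      true≢false ()
      forced-true : J a₀ ≢ ⋆ → forced (code a₀) ≡ true
      forced-true known = dec-true (em {Forceable (forcedBelow (code a₀)) (code a₀)})
        (J , SJ , (λ unknown lt → trans (forcedBelow-forced lt) (avoids unknown)) ,
         λ unknown code≡ → known (subst (λ x → J x ≡ ⋆) (code-injective code≡) unknown))

    minimal-unknowns : IsClosed S → ∃ λ K → S K × (∀ {J} → S J → J ⊆ᵘ K → K ⊆ᵘ J)
    minimal-unknowns closed = K , S-K , minimal
      where
      F : ℕ → (A → V) → Set
      F m J = S J × AvoidsBelow forced m J
      approximation : ∃ λ K → ∀ n m → ∃ λ J → F m J × AgreeBelow n J K
      approximation = compactness F
        (λ m≤m′ (SJ , avoids) → SJ , λ unknown lt → avoids unknown (<-≤-trans lt m≤m′))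
        forced-satisfiable
      K : A → V
      K = proj₁ approximation
      S-K : S K
      S-K = closed K λ xs →
        let n , bounded = eventually-all xs (λ b → suc (code b) , id)
            J , (SJ , _) , agree = proj₂ approximation n 0
        in J , SJ , λ b∈ → agree (bounded ≤-refl b∈)
      K-avoids : ∀ {a} → K a ≡ ⋆ → forced (code a) ≡ false
      K-avoids {a} unknown =
        let J , (_ , avoids) , agree = proj₂ approximation (suc (code a)) (suc (code a))
        in avoids (trans (agree ≤-refl) unknown) ≤-refl
      minimal : ∀ {J} → S J → J ⊆ᵘ K → K ⊆ᵘ J
      minimal SJ J⊆K a unknown = unforced-unknown SJ (λ {b} → K-avoids ∘ J⊆K b) (K-avoids unknown)

-- A Gödel numbering of ground atoms

-- ℕᵇ is the free type of binary words (εᵇ, 2[1+_], 1+[2_]) and toℕᵇ is injective, so a prefix-free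
-- word encoding of ground atoms yields an injective code into ℕ.
unary : ℕ → ℕᵇ → ℕᵇ
unary zero    y = 1+[2 y ]
unary (suc k) y = 2[1+ unary k y ]

unary-injective : ∀ m m′ {y y′} → unary m y ≡ unary m′ y′ → m ≡ m′ × y ≡ y′
unary-injective zero    zero     e = refl , 1+[2_]-injective e
unary-injective (suc m) (suc m′) e with unary-injective m m′ (2[1+_]-injective e)
... | refl , y≡y′ = refl , y≡y′

module AtomCode (L : Signature) where

  encodeTerm : GTerm L → ℕᵇ → ℕᵇ
  encodeTerms : ∀ {n} → Vec (GTerm L) n → ℕᵇ → ℕᵇ
  encodeTerm (gconst c)  y = 1+[2 unary (toℕ c) y ]
  encodeTerm (gapp f ts) y = 2[1+ unary (toℕ f) (encodeTerms ts y) ]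
  encodeTerms []       y = y
  encodeTerms (t ∷ ts) y = encodeTerm t (encodeTerms ts y)

  encodeTerm-injective : ∀ t t′ {y y′} → encodeTerm t y ≡ encodeTerm t′ y′ → t ≡ t′ × y ≡ y′
  encodeTerms-injective : ∀ {n} (ts ts′ : Vec (GTerm L) n) {y y′} →
                          encodeTerms ts y ≡ encodeTerms ts′ y′ → ts ≡ ts′ × y ≡ y′
  encodeTerm-injective (gconst c) (gconst c′) e with unary-injective (toℕ c) (toℕ c′) (1+[2_]-injective e)
  ... | c≡c′ , y≡y′ = cong gconst (toℕ-injective c≡c′) , y≡y′
  encodeTerm-injective (gapp f ts) (gapp f′ ts′) e with unary-injective (toℕ f) (toℕ f′) (2[1+_]-injective e)
  ... | f≡f′ , e′ with toℕ-injective f≡f′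
  ... | refl with encodeTerms-injective ts ts′ e′
  ... | refl , y≡y′ = refl , y≡y′
  encodeTerm-injective (gconst _)  (gapp _ _)  ()
  encodeTerm-injective (gapp _ _)  (gconst _)  ()
  encodeTerms-injective []       []         e = refl , e
  encodeTerms-injective (t ∷ ts) (t′ ∷ ts′) e with encodeTerm-injective t t′ e
  ... | refl , e′ with encodeTerms-injective ts ts′ e′
  ... | refl , y≡y′ = refl , y≡y′

  atomCode : GAtom L → ℕ
  atomCode (gatom p ts) = toℕᵇ (unary (toℕ p) (encodeTerms ts εᵇ))

  atomCode-injective : Injective _≡_ _≡_ atomCode
  atomCode-injective {gatom p ts} {gatom p′ ts′} e with unary-injective (toℕ p) (toℕ p′) (toℕᵇ-injective e)
  ... | p≡p′ , e′ with toℕ-injective p≡p′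
  ... | refl with encodeTerms-injective ts ts′ e′
  ... | refl , _ = refl

-- Derivations

module Derivations {L : Signature} (P : Program L) where

  data Der (Ok : GAtom L → Set) : GAtom L → Set where
    node : ∀ {a} (r : Rule (GAtom L)) → InGr P r → head r ≡ a →
           All Ok (neg r) → All (Der Ok) (pos r) → Der Ok a

  assumptions : ∀ {Ok a} → Der Ok a → List (GAtom L)
  assumptionsAll : ∀ {Ok ps} → All (Der Ok) ps → List (GAtom L)
  assumptions (node r _ _ _ ds) = neg r ++ assumptionsAll ds
  assumptionsAll []       = []
  assumptionsAll (d ∷ ds) = assumptions d ++ assumptionsAll ds

  restrict : ∀ {Ok Ok′ a} (t : Der Ok a) → (∀ {b} → b ∈ assumptions t → Ok b → Ok′ b) → Der Ok′ a
  restrictAll : ∀ {Ok Ok′ ps} (ds : All (Der Ok) ps) → (∀ {b} → b ∈ assumptionsAll ds → Ok b → Ok′ b) →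
                All (Der Ok′) ps
  restrict (node r g h ns ds) f =
    node r g h (All.tabulate λ b∈ → f (∈-++⁺ˡ b∈) (All.lookup ns b∈)) (restrictAll ds (f ∘ ∈-++⁺ʳ (neg r)))
  restrictAll []       _ = []
  restrictAll (d ∷ ds) f = restrict d (f ∘ ∈-++⁺ˡ) ∷ restrictAll ds (f ∘ ∈-++⁺ʳ (assumptions d))

  mono : ∀ {Ok Ok′ a} → (∀ {b} → Ok b → Ok′ b) → Der Ok a → Der Ok′ a
  mono f t = restrict t λ _ → f

  assumptionsAll-lookup : ∀ {Ok ps p} (ds : All (Der Ok) ps) (p∈ : p ∈ ps) →
                          ∀ {b} → b ∈ assumptions (All.lookup ds p∈) → b ∈ assumptionsAll ds
  assumptionsAll-lookup (d ∷ ds) (here refl) = ∈-++⁺ˡ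
  assumptionsAll-lookup (d ∷ ds) (there p∈)  = ∈-++⁺ʳ (assumptions d) ∘ assumptionsAll-lookup ds p∈

  -- Uni-rule makes two derivations of an atom use the same rules, hence the same assumptions.
  assumptions-unique : UniRule P → ∀ {Ok Ok′ a} (t : Der Ok a) (t′ : Der Ok′ a) →
                       ∀ {b} → b ∈ assumptions t′ → b ∈ assumptions t
  assumptionsAll-unique : UniRule P → ∀ {Ok Ok′ ps ps′} (ds : All (Der Ok) ps) (ds′ : All (Der Ok′) ps′) →
                          (∀ {p} → p ∈ ps′ → p ∈ ps) → ∀ {b} → b ∈ assumptionsAll ds′ → b ∈ assumptionsAll ds
  assumptions-unique uni (node r g h _ ds) (node r′ g′ h′ _ ds′) b∈
    with uni r r′ g g′ (trans h (sym h′)) | ∈-++⁻ (neg r′) b∈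
  ... | _ , _ , _ , _ , neg′⊆neg | inj₁ b∈neg = ∈-++⁺ˡ (neg′⊆neg b∈neg)
  ... | _ , _ , pos′⊆pos , _ , _ | inj₂ b∈ds =
    ∈-++⁺ʳ (neg r) (assumptionsAll-unique uni ds ds′ pos′⊆pos b∈ds)
  assumptionsAll-unique uni ds (d′ ∷ ds′) ps′⊆ps b∈ with ∈-++⁻ (assumptions d′) b∈
  ... | inj₁ b∈d′ = assumptionsAll-lookup ds (ps′⊆ps (here refl))
                      (assumptions-unique uni (All.lookup ds (ps′⊆ps (here refl))) d′ b∈d′)
  ... | inj₂ b∈ds′ = assumptionsAll-unique uni ds ds′ (ps′⊆ps ∘ there) b∈ds′

  transport : UniRule P → ∀ {Ok Ok′ Ok″ a} (t : Der Ok a) → Der Ok′ a →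
              (∀ {b} → b ∈ assumptions t → Ok′ b → Ok″ b) → Der Ok″ a
  transport uni t t′ f = restrict t′ (f ∘ assumptions-unique uni t t′)

-- Stable partial models as fixpoints of derivability

module StableModels (em : ExcludedMiddle 0ℓ) {L : Signature} (P : Program L) where
  open Derivations P

  Der⟨_⟩ : (V → Set) → Interp L → GAtom L → Set
  Der⟨ Q ⟩ J = Der (λ b → Q (J b))

  Certain Possible : Interp L → GAtom L → Set
  Certain  = Der⟨ _≡ 𝟘 ⟩
  Possible = Der⟨ _≢ 𝟙 ⟩

  certain⇒possible : ∀ {J a} → Certain J a → Possible J a
  certain⇒possible = mono ≡𝟘⇒≢𝟙

  Φ : Interp L → Interp L
  Φ J a with em {Certain J a} | em {Possible J a}
  ... | yes _ | _     = 𝟙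
  ... | no _  | yes _ = ⋆
  ... | no _  | no _  = 𝟘

  Φ-𝟙 : ∀ {J a} → Φ J a ≡ 𝟙 ⇔ Certain J a
  Φ-𝟙 {J} {a} = mk⇔ to′ from′
    where
    to′ : Φ J a ≡ 𝟙 → Certain J a
    to′ with em {Certain J a} | em {Possible J a}
    ... | yes c | _     = λ _ → c
    ... | no _  | yes _ = λ ()
    ... | no _  | no _  = λ ()
    from′ : Certain J a → Φ J a ≡ 𝟙
    from′ c with em {Certain J a}
    ... | yes _ = refl
    ... | no ¬c = ⊥-elim (¬c c)

  Φ-𝟘 : ∀ {J a} → Φ J a ≡ 𝟘 ⇔ (¬ Possible J a)
  Φ-𝟘 {J} {a} = mk⇔ to′ from′
    where
    to′ : Φ J a ≡ 𝟘 → ¬ Possible J a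
    to′ with em {Certain J a} | em {Possible J a}
    ... | yes _ | _     = λ ()
    ... | no _  | yes _ = λ ()
    ... | no _  | no ¬p = λ _ → ¬p
    from′ : ¬ Possible J a → Φ J a ≡ 𝟘
    from′ ¬p with em {Certain J a} | em {Possible J a}
    ... | yes c | _     = ⊥-elim (¬p (certain⇒possible c))
    ... | no _  | yes p = ⊥-elim (¬p p)
    ... | no _  | no _  = refl

  Φ-≢𝟘 : ∀ {J a} → Φ J a ≢ 𝟘 ⇔ Possible J a
  Φ-≢𝟘 {J} {a} = mk⇔ to′ (λ p Φ≡𝟘 → to Φ-𝟘 Φ≡𝟘 p)
    where
    to′ : Φ J a ≢ 𝟘 → Possible J a
    to′ with em {Certain J a} | em {Possible J a}
    ... | yes c | _     = λ _ → certain⇒possible c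
    ... | no _  | yes p = λ _ → p
    ... | no _  | no _  = λ Φ≢𝟘 → ⊥-elim (Φ≢𝟘 refl)

  countU-zero : ∀ (J : Interp L) ns → countU J ns ≡ 0 ⇔ All (λ b → J b ≡ 𝟘) ns
  countU-zero J ns = mk⇔ (to′ ns) (from′ ns)
    where
    to′ : ∀ ns → countU J ns ≡ 0 → All (λ b → J b ≡ 𝟘) ns
    to′ []       _ = []
    to′ (b ∷ ns) with J b in b≡
    ... | 𝟘 = λ e → b≡ ∷ to′ ns e
    ... | ⋆ = λ ()
    ... | 𝟙 = λ ()
    from′ : ∀ ns → All (λ b → J b ≡ 𝟘) ns → countU J ns ≡ 0
    from′ []       []                 = refl
    from′ (b ∷ ns) (b≡𝟘 ∷ ns≡𝟘) rewrite b≡𝟘 = from′ ns ns≡𝟘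

  body-𝟙 : ∀ (J K : Interp L) h ps ns →
           evalR K (rrule h ps (countU J ns)) ≡ 𝟙 ⇔ (All (λ p → K p ≡ 𝟙) ps × All (λ b → J b ≡ 𝟘) ns)
  body-𝟙 J K h ps ns = mk⇔
    (λ e → let ps≡𝟙 , u≡𝟙 = ++⁻ (map K ps) (to (conj-𝟙 _) e)
           in map⁻ ps≡𝟙 , to (countU-zero J ns) (to (replicate-⋆-𝟙 _) u≡𝟙))
    (λ (ps≡𝟙 , ns≡𝟘) → from (conj-𝟙 _)
       (++⁺ (map⁺ ps≡𝟙) (from (replicate-⋆-𝟙 _) (from (countU-zero J ns) ns≡𝟘))))

  body-≢𝟘 : ∀ (K : Interp L) h ps n → evalR K (rrule h ps n) ≢ 𝟘 ⇔ All (λ p → K p ≢ 𝟘) ps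
  body-≢𝟘 K h ps n = mk⇔
    (λ e → map⁻ (proj₁ (++⁻ (map K ps) (to (conj-≢𝟘 _) e))))
    (λ ps≢𝟘 → from (conj-≢𝟘 _) (++⁺ (map⁺ ps≢𝟘) (replicate-⋆-≢𝟘 n)))

  ReductClosed : Interp L → Interp L → Set
  ReductClosed J K = ∀ {r} → InGr P r → All (λ b → J b ≢ 𝟙) (neg r) →
    (All (λ p → K p ≡ 𝟙) (pos r) → All (λ b → J b ≡ 𝟘) (neg r) → K (head r) ≡ 𝟙) ×
    (All (λ p → K p ≢ 𝟘) (pos r) → K (head r) ≢ 𝟘)

  model⇔closed : ∀ {J K} → ModelOfReduct P J K ⇔ ReductClosed J K
  model⇔closed {J} {K} = mk⇔ to′ from′
    where
    to′ : ModelOfReduct P J K → ReductClosed J K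
    to′ M {r} g ns≢𝟙 =
      (λ ps≡𝟙 ns≡𝟘 → ≤t-𝟙 model (from (body-𝟙 J K (head r) (pos r) (neg r)) (ps≡𝟙 , ns≡𝟘))) ,
      (λ ps≢𝟘 → ≤t-≢𝟘 model (from (body-≢𝟘 K (head r) (pos r) (countU J (neg r))) ps≢𝟘))
      where
      model : evalR K (rrule (head r) (pos r) (countU J (neg r))) ≤t K (head r)
      model = M _ (r , g , ns≢𝟙 , refl)
    from′ : ReductClosed J K → ModelOfReduct P J K
    from′ C _ (r , g , ns≢𝟙 , refl) = ≤t-intro
      (uncurry (proj₁ (C g ns≢𝟙)) ∘ to (body-𝟙 J K (head r) (pos r) (neg r)))
      (proj₂ (C g ns≢𝟙) ∘ to (body-≢𝟘 K (head r) (pos r) (countU J (neg r))))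

  certain-sound : ∀ {J K} → ReductClosed J K → ∀ {a} → Certain J a → K a ≡ 𝟙
  certainAll-sound : ∀ {J K} → ReductClosed J K → ∀ {ps} → All (Certain J) ps → All (λ p → K p ≡ 𝟙) ps
  certain-sound C (node r g refl ns≡𝟘 ds) = proj₁ (C g (All.map ≡𝟘⇒≢𝟙 ns≡𝟘)) (certainAll-sound C ds) ns≡𝟘
  certainAll-sound C []       = []
  certainAll-sound C (d ∷ ds) = certain-sound C d ∷ certainAll-sound C ds

  possible-sound : ∀ {J K} → ReductClosed J K → ∀ {a} → Possible J a → K a ≢ 𝟘
  possibleAll-sound : ∀ {J K} → ReductClosed J K → ∀ {ps} → All (Possible J) ps → All (λ p → K p ≢ 𝟘) ps
  possible-sound C (node r g refl ns≢𝟙 ds) = proj₂ (C g ns≢𝟙) (possibleAll-sound C ds)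
  possibleAll-sound C []       = []
  possibleAll-sound C (d ∷ ds) = possible-sound C d ∷ possibleAll-sound C ds

  record Derived (J K : Interp L) : Set where
    field
      𝟙⇔certain   : ∀ a → K a ≡ 𝟙 ⇔ Certain J a
      ≢𝟘⇔possible : ∀ a → K a ≢ 𝟘 ⇔ Possible J a
  open Derived

  Fixpoint : Interp L → Set
  Fixpoint J = Derived J J

  Φ-derived : ∀ {J} → Derived J (Φ J)
  Φ-derived = record { 𝟙⇔certain = λ _ → Φ-𝟙 ; ≢𝟘⇔possible = λ _ → Φ-≢𝟘 }

  derived-closed : ∀ {J K} → Derived J K → ReductClosed J K
  derived-closed D g ns≢𝟙 =
    (λ ps≡𝟙 ns≡𝟘 → from (𝟙⇔certain D _) (node _ g refl ns≡𝟘 (All.map (λ {p} → to (𝟙⇔certain D p)) ps≡𝟙))) ,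
    (λ ps≢𝟘 → from (≢𝟘⇔possible D _) (node _ g refl ns≢𝟙 (All.map (λ {p} → to (≢𝟘⇔possible D p)) ps≢𝟘)))

  derived-least : ∀ {J K K′} → Derived J K → ReductClosed J K′ → ∀ a → K a ≤t K′ a
  derived-least D C a =
    ≤t-intro (certain-sound C ∘ to (𝟙⇔certain D a)) (possible-sound C ∘ to (≢𝟘⇔possible D a))

  fixpoint⇒stable : ∀ {J} → Fixpoint J → StablePartial P J
  fixpoint⇒stable F = from model⇔closed (derived-closed F) , λ _ M → derived-least F (to model⇔closed M)

  stable⇒fixpoint : ∀ {J} → StablePartial P J → Fixpoint J
  stable⇒fixpoint {J} (M , least) = record
    { 𝟙⇔certain   = λ a → mk⇔ (to Φ-𝟙 ∘ ≤t-𝟙 (J≤ΦJ a)) (certain-sound (to model⇔closed M))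
    ; ≢𝟘⇔possible = λ a → mk⇔ (to Φ-≢𝟘 ∘ ≤t-≢𝟘 (J≤ΦJ a)) (possible-sound (to model⇔closed M))
    }
    where
    J≤ΦJ : ∀ a → J a ≤t Φ J a
    J≤ΦJ = least (Φ J) (from model⇔closed (derived-closed Φ-derived))

  _⊑_ : Interp L → Interp L → Set
  I ⊑ J = ∀ a → I a ≢ ⋆ → J a ≡ I a

  ⊑-certain : ∀ {I J a} → I ⊑ J → Certain I a → Certain J a
  ⊑-certain I⊑J = mono λ {b} Ib≡𝟘 → trans (I⊑J b (≡𝟘⇒≢⋆ Ib≡𝟘)) Ib≡𝟘

  ⊑-possible : ∀ {I J a} → I ⊑ J → Possible J a → Possible I a
  ⊑-possible I⊑J = mono λ {b} Jb≢𝟙 Ib≡𝟙 → Jb≢𝟙 (trans (I⊑J b (≡𝟙⇒≢⋆ Ib≡𝟙)) Ib≡𝟙)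

  Φ-mono : ∀ {I J} → I ⊑ J → Φ I ⊑ Φ J
  Φ-mono {I} I⊑J a known with Φ I a in ΦIa≡
  ... | 𝟘 = from Φ-𝟘 (to Φ-𝟘 ΦIa≡ ∘ ⊑-possible I⊑J)
  ... | ⋆ = ⊥-elim (known refl)
  ... | 𝟙 = from Φ-𝟙 (⊑-certain I⊑J (to Φ-𝟙 ΦIa≡))

  iter : ℕ → Interp L
  iter zero    = λ _ → ⋆
  iter (suc k) = Φ (iter k)

  iter-mono : ∀ {k j} → k ≤ j → iter k ⊑ iter j
  iter-mono z≤n       _ known = ⊥-elim (known refl)
  iter-mono (s≤s k≤j) = Φ-mono (iter-mono k≤j)

  lim : Interp L
  lim a with em {∃ λ k → iter k a ≢ ⋆}
  ... | yes (k , _) = iter k a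
  ... | no _        = ⋆

  iter-⊑-lim : ∀ k → iter k ⊑ lim
  iter-⊑-lim k a known with em {∃ λ k → iter k a ≢ ⋆}
  ... | no none = ⊥-elim (none (k , known))
  ... | yes (k′ , known′) with ≤-total k k′
  ...   | inj₁ k≤k′ = iter-mono k≤k′ a known
  ...   | inj₂ k′≤k = sym (iter-mono k′≤k a known′)

  lim-settles : ∀ a → Eventually (λ j → lim a ≢ ⋆ → iter j a ≡ lim a)
  lim-settles a with em {∃ λ k → iter k a ≢ ⋆}
  ... | yes (k , known) = k , λ k≤j _ → iter-mono k≤j a known
  ... | no _            = 0 , λ _ unknown → ⊥-elim (unknown refl)

  lim-certain⇒𝟙 : ∀ {a} → Certain lim a → lim a ≡ 𝟙
  lim-certain⇒𝟙 {a} t =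
    let K , settled = eventually-all (assumptions t) lim-settles
        iter≡𝟙 : iter (suc K) a ≡ 𝟙
        iter≡𝟙 = from Φ-𝟙 (restrict t λ b∈ lim≡𝟘 → trans (settled ≤-refl b∈ (≡𝟘⇒≢⋆ lim≡𝟘)) lim≡𝟘)
    in trans (iter-⊑-lim (suc K) a (≡𝟙⇒≢⋆ iter≡𝟙)) iter≡𝟙

  lim-𝟙⇒certain : ∀ {a} → lim a ≡ 𝟙 → Certain lim a
  lim-𝟙⇒certain {a} lim≡𝟙 =
    let K , settled = lim-settles a
    in ⊑-certain (iter-⊑-lim K) (to Φ-𝟙 (trans (settled (n≤1+n K) (≡𝟙⇒≢⋆ lim≡𝟙)) lim≡𝟙))

  lim-possible⇒≢𝟘 : ∀ {a} → Possible lim a → lim a ≢ 𝟘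
  lim-possible⇒≢𝟘 {a} t lim≡𝟘 =
    let K , settled = lim-settles a
    in to Φ-𝟘 (trans (settled (n≤1+n K) (≡𝟘⇒≢⋆ lim≡𝟘)) lim≡𝟘) (⊑-possible (iter-⊑-lim K) t)

  module _ (uni : UniRule P) where

    -- a is possible at every stage; lim has settled on the assumptions of the stage-0 derivation by
    -- some stage K, and by uni-rule the stage-K derivation uses no other assumptions.
    lim-≢𝟘⇒possible : ∀ {a} → lim a ≢ 𝟘 → Possible lim a
    lim-≢𝟘⇒possible {a} lim≢𝟘 =
      let K , settled = eventually-all (assumptions (possible 0)) lim-settles
      in transport uni (possible 0) (possible K) λ b∈ iter≢𝟙 lim≡𝟙 →
           iter≢𝟙 (trans (settled ≤-refl b∈ (≡𝟙⇒≢⋆ lim≡𝟙)) lim≡𝟙)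
      where
      possible : ∀ k → Possible (iter k) a
      possible k = em⇒dne em λ ¬possible → let iter≡𝟘 = from Φ-𝟘 ¬possible in
        lim≢𝟘 (trans (iter-⊑-lim (suc k) a (≡𝟘⇒≢⋆ iter≡𝟘)) iter≡𝟘)

    lim-fixpoint : Fixpoint lim
    lim-fixpoint = record
      { 𝟙⇔certain   = λ _ → mk⇔ lim-𝟙⇒certain lim-certain⇒𝟙
      ; ≢𝟘⇔possible = λ _ → mk⇔ lim-≢𝟘⇒possible lim-possible⇒≢𝟘
      }

    -- A derivation for one stable approximant fixes, by uni-rule, the assumptions of every derivation
    -- of a; a second approximant agreeing with J on them carries a derivation over to J.
    closure-derived : (Q R : V → Set) → (∀ {J} → StablePartial P J → ∀ a → R (J a) ⇔ Der⟨ Q ⟩ J a) →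
                      ∀ {J} → InClosure (StablePartial P) J → ∀ a → R (J a) ⇔ Der⟨ Q ⟩ J a
    closure-derived Q R stable-derived {J} approx a = mk⇔ to′ from′
      where
      to′ : R (J a) → Der⟨ Q ⟩ J a
      to′ Ra =
        let J₁ , stable₁ , agree₁ = approx (a ∷ [])
            t₁ = to (stable-derived stable₁ a) (subst R (sym (agree₁ (here refl))) Ra)
            J₂ , stable₂ , agree₂ = approx (a ∷ assumptions t₁)
            t₂ = to (stable-derived stable₂ a) (subst R (sym (agree₂ (here refl))) Ra)
        in transport uni t₁ t₂ λ b∈ → subst Q (agree₂ (there b∈))
      from′ : Der⟨ Q ⟩ J a → R (J a)
      from′ t =
        let _ , stable , agree = approx (a ∷ assumptions t)
            t′ = restrict t λ b∈ → subst Q (sym (agree (there b∈)))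
        in subst R (agree (here refl)) (from (stable-derived stable a) t′)

    closure⇒fixpoint : ∀ {J} → InClosure (StablePartial P) J → Fixpoint J
    closure⇒fixpoint approx = record
      { 𝟙⇔certain   = closure-derived (_≡ 𝟘) (_≡ 𝟙) (λ stable → 𝟙⇔certain (stable⇒fixpoint stable)) approx
      ; ≢𝟘⇔possible = closure-derived (_≢ 𝟙) (_≢ 𝟘) (λ stable → ≢𝟘⇔possible (stable⇒fixpoint stable)) approx
      }

    stable-closed : IsClosed (StablePartial P)
    stable-closed _ = fixpoint⇒stable ∘ closure⇒fixpoint

theoremC1 : ExcludedMiddle 0ℓ → (L : Signature) (P : Program L) →
    UniRule P → ∃ (λ (I : Interp L) → LStable P I)
theoremC1 em L P uni =
  let I , stable-I , minimal = minimal-unknowns (StablePartial P) (lim , fixpoint⇒stable (lim-fixpoint uni))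
                                                 (stable-closed uni)
  in I , stable-I , λ (J , stable-J , J⊆I , a , Ia≡⋆ , Ja≢⋆) → Ja≢⋆ (minimal stable-J J⊆I a Ia≡⋆)
  where
  open AtomCode L
  open StableModels em P
  open Countable em atomCode atomCode-injective
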